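{- Let $n\ge 1$. A permutation $\pi=(\pi_1,\ldots,\pi_n)$ of $\{1,\ldots,n\}$ is convex, i.e., satisfies $\pi_2-\pi_1\le\pi_3-\pi_2\le\cdots\le\pi_n-\pi_{n-1}$, if and only if $\pi$ is one of (i) $(1,2,\ldots,n)$; (ii) $(n,1,2,\ldots,n-1)$; (iii) $(n-1,1,2,\ldots,n-2,n)$; (iv) the permutation whose permutation matrix is $\Pi^*_n$; or is obtained by reversing the order of the entries (equivalently, reversing the order of the rows of the permutation matrix) of one of these four permutations.
   Context: The permutation matrix of $\sigma\in\mathcal{S}_n$ has $1$ in positions $(i,\sigma_i)$ and $0$ elsewhere. For $k\ge1$, $\pi_{(k)}\in\mathcal{S}_k$ is defined by $\pi_{(k)}=(p,p+1,p-1,p+2,p-2,p+3,\ldots,1,k)$ if $k=2p$, and $\pi_{(k)}=(p+1,p+2,p,p+3,p-1,p+4,\ldots,k,1)$ if $k=2p+1$; $\Pi_k$ is its permutation matrix. $\Pi^*_n$ is the matrix obtained from $\Pi_n$ by rotating it counter-clockwise by $90$ degrees, i.e., the entry in position $(i,j)$ of $\Pi_n$ is moved to position $(n+1-j,\,i)$. For example, $\Pi^*_6$ corresponds to the permutation $(6,4,2,1,3,5)$. -}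

module Defs where

open import Data.Nat using (ℕ; zero; suc; _+_; _∸_; _≤_; _/_; _%_)
open import Data.Nat.Properties using (_≟_)
open import Data.Fin using (Fin; toℕ; opposite)
open import Data.Vec using (Vec; []; _∷_; lookup; tabulate; reverse; toList)
open import Data.List using (List; []; _∷_)
open import Data.Integer as ℤ using (ℤ; +_)
open import Data.Product using (Σ; _×_; _,_)
open import Data.Sum using (_⊎_)
open import Data.Unit using (⊤)
open import Relation.Nullary using (yes; no)
open import Relation.Binary.PropositionalEquality using (_≡_; refl)

Convex : List ℕ → Set
Convex (a ∷ b ∷ c ∷ rest) =
  ((+ b) ℤ.- (+ a) ℤ.≤ (+ c) ℤ.- (+ b)) × Convex (b ∷ c ∷ rest)
Convex _ = ⊤

IsPerm : {n : ℕ} → Vec ℕ n → Set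
IsPerm {n} π =
  ((i : Fin n) → (1 ≤ lookup π i) × (lookup π i ≤ n)) ×
  ((i j : Fin n) → lookup π i ≡ lookup π j → i ≡ j)

-- Permutation matrix: entry (i,j) is 1 iff π_i = j (1-based; Fin is 0-based).
Matrix : ℕ → Set
Matrix n = Fin n → Fin n → ℕ

permMatrix : {n : ℕ} → Vec ℕ n → Matrix n
permMatrix π i j with lookup π i ≟ suc (toℕ j)
... | yes _ = 1
... | no  _ = 0

-- Counter-clockwise rotation by 90°: entry at (i,j) moves to (n+1-j, i).
-- So the new entry at (a,b) is the old entry at (b, n+1-a).
rotCCW : {n : ℕ} → Matrix n → Matrix n
rotCCW M a b = M b (opposite a)

-- π_(k) in one-line notation, entry at 0-based position i.
-- k = 2p   : (p, p+1, p-1, p+2, p-2, …, 1, 2p)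
--            position 2j ↦ p - j,  position 2j+1 ↦ p+1+j
-- k = 2p+1 : (p+1, p+2, p, p+3, p-1, …, 2p+1, 1)
--            position 2j ↦ p+1-j,  position 2j+1 ↦ p+2+j
piEntry : ℕ → ℕ → ℕ
piEntry k i with k % 2 | i % 2
... | 0 | 0 = (k / 2) ∸ (i / 2)
... | 0 | _ = suc (k / 2) + (i / 2)
... | _ | 0 = suc (k / 2) ∸ (i / 2)
... | _ | _ = suc (suc (k / 2)) + (i / 2)

piPerm : (k : ℕ) → Vec ℕ k
piPerm k = tabulate (λ i → piEntry k (toℕ i))

Pi : (k : ℕ) → Matrix k
Pi k = permMatrix (piPerm k)

PiStar : (n : ℕ) → Matrix n
PiStar n = rotCCW (Pi n)

permI : (n : ℕ) → Vec ℕ n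
permI n = tabulate (λ i → suc (toℕ i))

permII : (n : ℕ) → Vec ℕ n
permII n = tabulate f
  where
  f : Fin n → ℕ
  f i with toℕ i
  ... | zero  = n
  ... | suc m = suc m

-- (iii) (n-1,1,2,…,n-2,n)  (for n = 1 this is read as (1))
permIII : (n : ℕ) → Vec ℕ n
permIII n = tabulate f
  where
  f : Fin n → ℕ
  f i with toℕ i ≟ n ∸ 1 | toℕ i
  ... | yes _ | _     = n
  ... | no  _ | zero  = n ∸ 1
  ... | no  _ | suc m = suc m

Base : {n : ℕ} → Vec ℕ n → Set
Base {n} σ =
  σ ≡ permI n ⊎ σ ≡ permII n ⊎ σ ≡ permIII n ⊎
  ((a b : Fin n) → permMatrix σ a b ≡ PiStar n a b)

Listed : {n : ℕ} → Vec ℕ n → Set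
Listed {n} π = Base π ⊎ Σ (Vec ℕ n) (λ σ → Base σ × π ≡ reverse σ)

private
  _ : piPerm 6 ≡ 3 ∷ 4 ∷ 2 ∷ 5 ∷ 1 ∷ 6 ∷ []
  _ = refl
  _ : piPerm 7 ≡ 4 ∷ 5 ∷ 3 ∷ 6 ∷ 2 ∷ 7 ∷ 1 ∷ []
  _ = refl
  _ : permII 4 ≡ 4 ∷ 1 ∷ 2 ∷ 3 ∷ []
  _ = refl
  _ : permIII 5 ≡ 4 ∷ 1 ∷ 2 ∷ 3 ∷ 5 ∷ []
  _ = refl
  _ : tabulate (λ a → tabulate (λ b → PiStar 6 a b))
      ≡ tabulate (λ a → tabulate (λ b → permMatrix (6 ∷ 4 ∷ 2 ∷ 1 ∷ 3 ∷ 5 ∷ []) a b))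
  _ = refl

-- The maximum n of a convex permutation sits at one of its two ends: an interior entry has
-- neighbours summing to at most 2(n − 1) < 2n.  After reversing if necessary it is the last
-- entry, and the others form a convex permutation of length n − 1, listed by induction.
-- Appending n to a listed shape either gives a listed shape again or makes the last three
-- entries strictly concave; the few short exceptions coincide with other shapes and are settled
-- by evaluation.  Conversely the four shapes are convex, and reversal preserves convexity.

module Submission where

open import Defs
open import Data.Nat using (ℕ; zero; suc; _+_; _*_; _∸_; _/_; _%_; _≤_; _<_; z≤n; s≤s; s≤s⁻¹; ⌊_/2⌋)
open import Data.Nat.Properties
open import Data.Nat.DivMod using (m*n%n≡0; m*n/n≡m; [m+kn]%n≡m%n; +-distrib-/; /-congˡ)
open import Data.Nat.Tactic.RingSolver using (solve-∀)
import Data.Integer as ℤ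
import Data.Integer.Properties as ℤₚ
import Data.Integer.Tactic.RingSolver as ℤ-Solver
open import Data.Fin using (Fin; toℕ; fromℕ<; opposite)
import Data.Fin.Properties as Finₚ
open import Data.Vec using (Vec; []; _∷_; lookup; reverse; toList; _∷ʳ_)
open import Data.Vec.Properties using (lookup∘tabulate; reverse-∷; reverse-involutive)
open import Data.Product using (∃-syntax; ∃₂; _×_; _,_; proj₁; proj₂)
open import Data.Sum using (_⊎_; inj₁; inj₂)
open import Data.Empty using (⊥; ⊥-elim)
open import Data.Unit using (tt)
open import Function.Base using (_∋_)
open import Function.Bundles using (_⇔_; mk⇔; Equivalence)
open import Relation.Nullary using (Dec; yes; no)
open import Relation.Nullary.Decidable using (True; toWitness)
open import Relation.Binary.PropositionalEquality

infix 4 _≗[_]_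

_≗[_]_ : (ℕ → ℕ) → ℕ → (ℕ → ℕ) → Set
f ≗[ n ] g = ∀ i → i < n → f i ≡ g i

≗-sym : ∀ {n f g} → f ≗[ n ] g → g ≗[ n ] f
≗-sym f≗g i i<n = sym (f≗g i i<n)

≗-trans : ∀ {n f g h} → f ≗[ n ] g → g ≗[ n ] h → f ≗[ n ] h
≗-trans f≗g g≗h i i<n = trans (f≗g i i<n) (g≗h i i<n)

≗-snoc : ∀ {n f g} → f ≗[ n ] g → f n ≡ g n → f ≗[ suc n ] g
≗-snoc {n} f≗g fn≡gn i i<1+n with m<1+n⇒m<n∨m≡n i<1+n
... | inj₁ i<n  = f≗g i i<n
... | inj₂ refl = fn≡gn

≗-dec : ∀ n f g → Dec (f ≗[ n ] g)
≗-dec zero    f g = yes λ _ ()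
≗-dec (suc n) f g with ≗-dec n f g | f n ≟ g n
... | yes f≗g | yes fn≡gn = yes (≗-snoc f≗g fn≡gn)
... | yes _   | no fn≢gn  = no λ f≗g → fn≢gn (f≗g n (n<1+n n))
... | no ¬f≗g | _         = no λ f≗g → ¬f≗g λ i i<n → f≗g i (m<n⇒m<1+n i<n)

≗-by-evaluation : ∀ n f g → {True (≗-dec n f g)} → f ≗[ n ] g
≗-by-evaluation n f g {t} = toWitness t

ConvexOn : ℕ → (ℕ → ℕ) → Set
ConvexOn n p = ∀ i → 2 + i < n → p (1 + i) + p (1 + i) ≤ p i + p (2 + i)

PermutationOn : ℕ → (ℕ → ℕ) → Set
PermutationOn n p =
  (∀ i → i < n → 1 ≤ p i × p i ≤ n) × (∀ i j → i < n → j < n → p i ≡ p j → i ≡ j)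

reverseOn : ℕ → (ℕ → ℕ) → ℕ → ℕ
reverseOn n p i = p (n ∸ suc i)

convex-≗ : ∀ {n p q} → p ≗[ n ] q → ConvexOn n q → ConvexOn n p
convex-≗ {p = p} {q} p≗q C i 2+i<n
  rewrite p≗q i (<-trans (n<1+n i) (<-trans (n<1+n (suc i)) 2+i<n))
        | p≗q (1 + i) (<-trans (n<1+n (suc i)) 2+i<n)
        | p≗q (2 + i) 2+i<n = C i 2+i<n

convex-restrict : ∀ {n p} → ConvexOn (suc n) p → ConvexOn n p
convex-restrict C i 2+i<n = C i (m<n⇒m<1+n 2+i<n)

convex-raise-ends : ∀ {n p q} → ConvexOn n p → (∀ i → i < n → p i ≤ q i) →
                    (∀ i → 0 < i → suc i < n → p i ≡ q i) → ConvexOn n q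
convex-raise-ends {p = p} {q} C p≤q interior i 2+i<n = begin
  q (1 + i) + q (1 + i) ≡⟨ cong (λ x → x + x) (sym (interior (1 + i) (s≤s z≤n) 2+i<n)) ⟩
  p (1 + i) + p (1 + i) ≤⟨ C i 2+i<n ⟩
  p i + p (2 + i)       ≤⟨ +-mono-≤ (p≤q i (<-trans (n<1+n i) (<-trans (n<1+n (suc i)) 2+i<n)))
                                    (p≤q (2 + i) 2+i<n) ⟩
  q i + q (2 + i)       ∎
  where open ≤-Reasoning

shift-convex : ∀ n c → ConvexOn n (c +_)
shift-convex n c i _ = ≤-reflexive (affine c i)
  where
  affine : ∀ c i → (c + suc i) + (c + suc i) ≡ (c + i) + (c + suc (suc i))
  affine = solve-∀

reverseOn-shift : ∀ k i a f → reverseOn (suc (k + (i + a))) f i ≡ f (k + a)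
reverseOn-shift k i a f = cong f (trans (+-∸-assoc k (m≤m+n i a)) (cong (k +_) (m+n∸m≡n i a)))

n∸1+i<n : ∀ {n i} → i < n → n ∸ suc i < n
n∸1+i<n {suc n} {i} (s≤s _) = s≤s (m∸n≤m n i)

n∸1+[n∸1+i]≡i : ∀ {n i} → i < n → n ∸ suc (n ∸ suc i) ≡ i
n∸1+[n∸1+i]≡i {suc n} (s≤s i≤n) = m∸[m∸n]≡n i≤n

reverseOn-cong : ∀ {n f g} → f ≗[ n ] g → reverseOn n f ≗[ n ] reverseOn n g
reverseOn-cong f≗g i i<n = f≗g _ (n∸1+i<n i<n)

reverseOn-involutive : ∀ n f → reverseOn n (reverseOn n f) ≗[ n ] f
reverseOn-involutive n f i i<n = cong f (n∸1+[n∸1+i]≡i i<n)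

reverseOn-permutation : ∀ {n p} → PermutationOn n p → PermutationOn n (reverseOn n p)
reverseOn-permutation {n} (range , injective) =
  (λ i i<n → range _ (n∸1+i<n i<n)) ,
  (λ i j i<n j<n e → begin
     i                     ≡⟨ n∸1+[n∸1+i]≡i i<n ⟨
     n ∸ suc (n ∸ suc i)   ≡⟨ cong (λ x → n ∸ suc x) (injective _ _ (n∸1+i<n i<n) (n∸1+i<n j<n) e) ⟩
     n ∸ suc (n ∸ suc j)   ≡⟨ n∸1+[n∸1+i]≡i j<n ⟩
     j                     ∎)
  where open ≡-Reasoning

-- Abstracting n ∸ (3 + i) as a turns n into 3 + i + a; the reversal then reads p at 2 + a, 1 + a, a.
reverseOn-convex : ∀ {n p} → ConvexOn n p → ConvexOn n (reverseOn n p)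
reverseOn-convex {n} {p} C i 3+i≤n with n ∸ (3 + i) | m+[n∸m]≡n 3+i≤n
... | a | refl = subst₂ _≤_ (sym (cong₂ _+_ middle middle))
                            (sym (trans (cong (_+ p a) first) (+-comm (p (2 + a)) (p a))))
                            (C a (s≤s (s≤s (s≤s (m≤n+m a i)))))
  where
  first  = reverseOn-shift 2 i a p
  middle = reverseOn-shift 1 (1 + i) a p

zigzag : ℕ → ℕ → ℕ
zigzag P i with i <? P
... | yes _ = (P ∸ i) + (P ∸ i)
... | no  _ = suc ((i ∸ P) + (i ∸ P))

zigzag-< : ∀ {P i} → i < P → zigzag P i ≡ (P ∸ i) + (P ∸ i)
zigzag-< {P} {i} i<P with i <? P
... | yes _  = refl
... | no i≮P = ⊥-elim (i≮P i<P)

zigzag-≥ : ∀ {P i} → P ≤ i → zigzag P i ≡ suc ((i ∸ P) + (i ∸ P))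
zigzag-≥ {P} {i} P≤i with i <? P
... | yes i<P = ⊥-elim (<⇒≱ i<P P≤i)
... | no _    = refl

zigzag-+ : ∀ P t → zigzag P (P + t) ≡ suc (t + t)
zigzag-+ P t = trans (zigzag-≥ (m≤m+n P t)) (cong (λ x → suc (x + x)) (m+n∸m≡n P t))

zigzag-suc : ∀ P i → zigzag (suc P) (suc i) ≡ zigzag P i
zigzag-suc P i with i <? P
... | yes i<P = zigzag-< (s≤s i<P)
... | no i≮P  = zigzag-≥ (s≤s (≮⇒≥ i≮P))

zigzag-convex : ∀ P i → zigzag P (1 + i) + zigzag P (1 + i) ≤ zigzag P i + zigzag P (2 + i)
zigzag-convex zero i
  rewrite zigzag-≥ {0} {i} z≤n | zigzag-≥ {0} {1 + i} z≤n | zigzag-≥ {0} {2 + i} z≤n =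
  ≤-reflexive (odd-affine i)
  where
  odd-affine : ∀ i → suc (suc i + suc i) + suc (suc i + suc i) ≡ suc (i + i) + suc (suc (suc i) + suc (suc i))
  odd-affine = solve-∀
zigzag-convex (suc P) (suc i)
  rewrite zigzag-suc P i | zigzag-suc P (1 + i) | zigzag-suc P (2 + i) = zigzag-convex P i
zigzag-convex 1 zero = m≤m+n 2 3
zigzag-convex 2 zero = m≤m+n 4 1
zigzag-convex (suc (suc (suc P))) zero
  rewrite zigzag-< {3 + P} {0} (s≤s z≤n) | zigzag-< {3 + P} {1} (s≤s (s≤s z≤n))
        | zigzag-< {3 + P} {2} (s≤s (s≤s (s≤s z≤n))) = ≤-reflexive (even-affine P)
  where
  even-affine : ∀ P → (2 + P + (2 + P)) + (2 + P + (2 + P)) ≡ (3 + P + (3 + P)) + (1 + P + (1 + P))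
  even-affine = solve-∀

rotation : ℕ → ℕ → ℕ
rotation n zero    = n
rotation n (suc i) = suc i

prefixRotation : ℕ → ℕ → ℕ
prefixRotation n i with i ≟ n ∸ 1
... | yes _ = n
... | no  _ = rotation (n ∸ 1) i

prefixRotation-last : ∀ m → prefixRotation (suc m) m ≡ suc m
prefixRotation-last m with m ≟ m
... | yes _  = refl
... | no m≢m = ⊥-elim (m≢m refl)

prefixRotation-init : ∀ {m i} → i ≢ m → prefixRotation (suc m) i ≡ rotation m i
prefixRotation-init {m} {i} i≢m with i ≟ m
... | yes i≡m = ⊥-elim (i≢m i≡m)
... | no _    = refl

-- The base permutations (i)–(iv), 0-indexed; valley is (2P, 2P − 2, …, 2, 1, 3, 5, …) with
-- P = ⌊n/2⌋, the one-line form of the permutation whose matrix is Π*_n.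
data Shape : Set where
  ascending rotated prefixRotated valley : Shape

shape : Shape → ℕ → ℕ → ℕ
shape ascending      _ = suc
shape rotated        n = rotation n
shape prefixRotated  n = prefixRotation n
shape valley         n = zigzag ⌊ n /2⌋

ListedOn : ℕ → (ℕ → ℕ) → Set
ListedOn n p = ∃[ s ] (p ≗[ n ] shape s n ⊎ p ≗[ n ] reverseOn n (shape s n))

rotation-convex : ∀ n → ConvexOn n (rotation n)
rotation-convex n = convex-raise-ends (shift-convex n 0) id≤rotation (λ { (suc i) _ _ → refl })
  where
  id≤rotation : ∀ i → i < n → i ≤ rotation n i
  id≤rotation zero    _ = z≤n
  id≤rotation (suc i) _ = ≤-refl

prefixRotation-convex : ∀ n → ConvexOn n (prefixRotation n)
prefixRotation-convex zero    _ ()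
prefixRotation-convex (suc m) = convex-raise-ends (shift-convex (suc m) 0) id≤ interior
  where
  id≤ : ∀ i → i < suc m → i ≤ prefixRotation (suc m) i
  id≤ i i<1+m with i ≟ m
  ... | yes _ = <⇒≤ i<1+m
  id≤ zero    _ | no _ = z≤n
  id≤ (suc i) _ | no _ = ≤-refl
  interior : ∀ i → 0 < i → suc i < suc m → i ≡ prefixRotation (suc m) i
  interior (suc i) _ 2+i<1+m = sym (prefixRotation-init (<⇒≢ (s≤s⁻¹ 2+i<1+m)))

shape-convex : ∀ s n → ConvexOn n (shape s n)
shape-convex ascending     n = shift-convex n 1
shape-convex rotated       n = rotation-convex n
shape-convex prefixRotated n = prefixRotation-convex n
shape-convex valley        n i _ = zigzag-convex ⌊ n /2⌋ i

listed⇒convex : ∀ {n p} → ListedOn n p → ConvexOn n p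
listed⇒convex {n} (s , inj₁ p≗s) = convex-≗ p≗s (shape-convex s n)
listed⇒convex {n} (s , inj₂ p≗rs) = convex-≗ p≗rs (reverseOn-convex {p = shape s n} (shape-convex s n))

maximum-attained : ∀ {m p} → PermutationOn (suc m) p → ∃[ i ] (i < suc m × p i ≡ suc m)
maximum-attained {m} {p} (range , injective) with Finₚ.any? (λ k → p (toℕ k) ≟ suc m)
... | yes (k , pk≡1+m) = toℕ k , Finₚ.toℕ<n k , pk≡1+m
... | no ¬attained     = ⊥-elim (Finₚ.<⇒notInjective (n<1+n m) squeeze-injective)
  where
  value-1<m : ∀ k → p (toℕ k) ∸ 1 < m
  value-1<m k = ∸-monoˡ-< (≤∧≢⇒< (proj₂ (range _ (Finₚ.toℕ<n k))) λ e → ¬attained (k , e))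
                          (proj₁ (range _ (Finₚ.toℕ<n k)))
  squeeze : Fin (suc m) → Fin m
  squeeze k = fromℕ< (value-1<m k)
  squeeze-injective : ∀ {k l} → squeeze k ≡ squeeze l → k ≡ l
  squeeze-injective {k} {l} e = Finₚ.toℕ-injective (injective _ _ (Finₚ.toℕ<n k) (Finₚ.toℕ<n l)
    (∸-cancelʳ-≡ (proj₁ (range _ (Finₚ.toℕ<n k))) (proj₁ (range _ (Finₚ.toℕ<n l)))
      (begin
        p (toℕ k) ∸ 1           ≡⟨ Finₚ.toℕ-fromℕ< (value-1<m k) ⟨
        toℕ (squeeze k)         ≡⟨ cong toℕ e ⟩
        toℕ (squeeze l)         ≡⟨ Finₚ.toℕ-fromℕ< (value-1<m l) ⟩
        p (toℕ l) ∸ 1           ∎)))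
    where open ≡-Reasoning

permutation-below-maximum : ∀ {n p i c} → PermutationOn (suc n) p → p c ≡ suc n →
                            i < suc n → c < suc n → i ≢ c → p i ≤ n
permutation-below-maximum (range , injective) pc≡1+n i<1+n c<1+n i≢c =
  s≤s⁻¹ (≤∧≢⇒< (proj₂ (range _ i<1+n))
                λ pi≡1+n → i≢c (injective _ _ i<1+n c<1+n (trans pi≡1+n (sym pc≡1+n))))

maximum-at-end : ∀ {m p i} → PermutationOn (2 + m) p → ConvexOn (2 + m) p →
                 i < 2 + m → p i ≡ 2 + m → i ≡ 0 ⊎ i ≡ 1 + m
maximum-at-end {i = zero} _ _ _ _ = inj₁ refl
maximum-at-end {m} {p} {suc j} P C 1+j<2+m pi≡2+m with m<1+n⇒m<n∨m≡n 1+j<2+m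
... | inj₂ 1+j≡1+m = inj₂ 1+j≡1+m
... | inj₁ 1+j<1+m =
  ⊥-elim (<⇒≱ neighbours<peak (subst (λ x → x + x ≤ p j + p (2 + j)) pi≡2+m (C j (s≤s 1+j<1+m))))
  where
  neighbours<peak : p j + p (2 + j) < (2 + m) + (2 + m)
  neighbours<peak = +-mono-< (s≤s (permutation-below-maximum P pi≡2+m (<-trans (n<1+n j) 1+j<2+m) 1+j<2+m λ ()))
                             (s≤s (permutation-below-maximum P pi≡2+m (s≤s 1+j<1+m) 1+j<2+m
                                     λ e → <-irrefl (sym e) (n<1+n (suc j))))

permutation-restrict : ∀ {n p} → PermutationOn (suc n) p → p n ≡ suc n → PermutationOn n p
permutation-restrict {n} P@(range , injective) pn≡1+n =
  (λ i i<n → proj₁ (range i (m<n⇒m<1+n i<n)) ,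
             permutation-below-maximum P pn≡1+n (m<n⇒m<1+n i<n) (n<1+n n) (<⇒≢ i<n)) ,
  (λ i j i<n j<n → injective i j (m<n⇒m<1+n i<n) (m<n⇒m<1+n j<n))

listed-reverse : ∀ {n p} → ListedOn n (reverseOn n p) → ListedOn n p
listed-reverse {n} {p} (s , inj₁ rp≗s)  =
  s , inj₂ (≗-trans (≗-sym (reverseOn-involutive n p)) (reverseOn-cong rp≗s))
listed-reverse {n} {p} (s , inj₂ rp≗rs) =
  s , inj₁ (≗-trans (≗-sym (reverseOn-involutive n p))
           (≗-trans (reverseOn-cong rp≗rs) (reverseOn-involutive n (shape s n))))

data EvenOrOdd : ℕ → Set where
  even : ∀ k → EvenOrOdd (k + k)
  odd  : ∀ k → EvenOrOdd (suc (k + k))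

even-or-odd : ∀ n → EvenOrOdd n
even-or-odd zero = even 0
even-or-odd (suc n) with even-or-odd n
... | even k = odd k
... | odd k  = subst EvenOrOdd (cong suc (+-suc k k)) (even (suc k))

⌊1+n+n/2⌋≡n : ∀ n → ⌊ suc (n + n) /2⌋ ≡ n
⌊1+n+n/2⌋≡n zero    = refl
⌊1+n+n/2⌋≡n (suc n) = cong suc (trans (cong ⌊_/2⌋ (+-suc n n)) (⌊1+n+n/2⌋≡n n))

valley-even : ∀ k i → shape valley (k + k) i ≡ zigzag k i
valley-even k i = cong (λ P → zigzag P i) (sym (n≡⌊n+n/2⌋ k))

valley-odd : ∀ k i → shape valley (suc (k + k)) i ≡ zigzag k i
valley-odd k i = cong (λ P → zigzag P i) (⌊1+n+n/2⌋≡n k)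

Grows : ℕ → (ℕ → ℕ) → (ℕ → ℕ) → Set
Grows m f g = f ≗[ m ] g × g m ≡ suc m

grow : ∀ {m p f g} → p ≗[ m ] f → Grows m f g → p m ≡ suc m → p ≗[ suc m ] g
grow p≗f (f≗g , gm≡1+m) pm≡1+m = ≗-snoc (≗-trans p≗f f≗g) (trans pm≡1+m (sym gm≡1+m))

ascending-grows : ∀ m → Grows m suc suc
ascending-grows m = (λ _ _ → refl) , refl

reversed-ascending-grows : ∀ m → Grows m (reverseOn m suc) (reverseOn (suc m) (rotation (suc m)))
reversed-ascending-grows m =
  (λ i i<m → sym (cong (rotation (suc m)) (+-∸-assoc 1 i<m))) ,
  cong (rotation (suc m)) (n∸n≡0 m)

rotation-grows : ∀ m → Grows m (rotation m) (prefixRotation (suc m))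
rotation-grows m = (λ i i<m → sym (prefixRotation-init (<⇒≢ i<m))) , prefixRotation-last m

valley-grows : ∀ k → Grows (k + k) (shape valley (k + k)) (shape valley (suc (k + k)))
valley-grows k = (λ i _ → trans (valley-even k i) (sym (valley-odd k i))) ,
                 trans (valley-odd k (k + k)) (zigzag-+ k k)

reversed-valley-grows : ∀ k → Grows (suc (k + k)) (reverseOn (suc (k + k)) (shape valley (suc (k + k))))
                                                 (reverseOn (2 + (k + k)) (shape valley (2 + (k + k))))
reversed-valley-grows k = agree , last
  where
  valley-2+even : ∀ i → shape valley (2 + (k + k)) i ≡ zigzag (suc k) i
  valley-2+even i = cong (λ P → zigzag (suc P) i) (sym (n≡⌊n+n/2⌋ k))
  agree : reverseOn (suc (k + k)) (shape valley (suc (k + k))) ≗[ suc (k + k) ]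
          reverseOn (2 + (k + k)) (shape valley (2 + (k + k)))
  agree i i<1+2k = begin
    shape valley (suc (k + k)) (k + k ∸ i)      ≡⟨ valley-odd k (k + k ∸ i) ⟩
    zigzag k (k + k ∸ i)                         ≡⟨ zigzag-suc k (k + k ∸ i) ⟨
    zigzag (suc k) (suc (k + k ∸ i))             ≡⟨ cong (zigzag (suc k)) (+-∸-assoc 1 (s≤s⁻¹ i<1+2k)) ⟨
    zigzag (suc k) (suc (k + k) ∸ i)             ≡⟨ valley-2+even (suc (k + k) ∸ i) ⟨
    shape valley (2 + (k + k)) (suc (k + k) ∸ i) ∎
    where open ≡-Reasoning
  last : reverseOn (2 + (k + k)) (shape valley (2 + (k + k))) (suc (k + k)) ≡ 2 + (k + k)
  last = begin
    shape valley (2 + (k + k)) (k + k ∸ (k + k)) ≡⟨ valley-2+even (k + k ∸ (k + k)) ⟩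
    zigzag (suc k) (k + k ∸ (k + k))             ≡⟨ cong (zigzag (suc k)) (n∸n≡0 (k + k)) ⟩
    zigzag (suc k) 0                             ≡⟨ zigzag-< (s≤s z≤n) ⟩
    suc k + suc k                                ≡⟨ cong suc (+-suc k k) ⟩
    2 + (k + k)                                  ∎
    where open ≡-Reasoning

extend-as-ascending : ∀ {m p f} → p ≗[ m ] f → {True (≗-dec m f suc)} → p m ≡ suc m → ListedOn (suc m) p
extend-as-ascending {m} {f = f} p≗f {f≗suc} pm≡1+m =
  ascending , inj₁ (grow (≗-trans p≗f (≗-by-evaluation m f suc {f≗suc})) (ascending-grows m) pm≡1+m)

concave-at-end : ∀ k p {x y z} → ConvexOn (3 + k) p → p k ≡ x → p (1 + k) ≡ y → p (2 + k) ≡ z →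
                 x + z < y + y → ⊥
concave-at-end k p C refl refl refl x+z<y+y = <⇒≱ x+z<y+y (C k ≤-refl)

<-by-surplus : ∀ {a b} d → b ≡ suc (d + a) → a < b
<-by-surplus {a} d refl = s≤s (m≤n+m a d)

extend-reversed-rotation : ∀ m p → p ≗[ m ] reverseOn m (rotation m) → p m ≡ suc m → ConvexOn (suc m) p →
                           ListedOn (suc m) p
extend-reversed-rotation 0 p p≗ pm _ = extend-as-ascending p≗ pm
extend-reversed-rotation 1 p p≗ pm _ = extend-as-ascending p≗ pm
extend-reversed-rotation 2 p p≗ pm _ = extend-as-ascending p≗ pm
extend-reversed-rotation (suc (suc (suc k))) p p≗ pm C = ⊥-elim (concave-at-end (1 + k) p C
  (trans (p≗ (1 + k) (m<n⇒m<1+n (n<1+n _))) (cong (rotation (3 + k)) (m+n∸n≡m 1 k)))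
  (trans (p≗ (2 + k) (n<1+n _)) (cong (rotation (3 + k)) (n∸n≡0 k)))
  pm (<-by-surplus k (surplus k)))
  where
  surplus : ∀ k → (3 + k) + (3 + k) ≡ suc (k + (1 + (4 + k)))
  surplus = solve-∀

extend-prefixRotation : ∀ m p → p ≗[ m ] prefixRotation m → p m ≡ suc m → ConvexOn (suc m) p →
                        ListedOn (suc m) p
extend-prefixRotation 0 p p≗ pm _ = extend-as-ascending p≗ pm
extend-prefixRotation 1 p p≗ pm _ = extend-as-ascending p≗ pm
extend-prefixRotation 2 p p≗ pm _ = extend-as-ascending p≗ pm
extend-prefixRotation (suc (suc (suc k))) p p≗ pm C = ⊥-elim (concave-at-end (1 + k) p C
  (trans (p≗ (1 + k) (m<n⇒m<1+n (n<1+n _))) (prefixRotation-init (<⇒≢ (n<1+n (1 + k)))))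
  (trans (p≗ (2 + k) (n<1+n _)) (prefixRotation-last (2 + k)))
  pm (<-by-surplus 0 (surplus k)))
  where
  surplus : ∀ k → (3 + k) + (3 + k) ≡ suc (0 + ((1 + k) + (4 + k)))
  surplus = solve-∀

extend-reversed-prefixRotation : ∀ m p → p ≗[ m ] reverseOn m (prefixRotation m) → p m ≡ suc m →
                                 ConvexOn (suc m) p → ListedOn (suc m) p
extend-reversed-prefixRotation 0 p p≗ pm _ = extend-as-ascending p≗ pm
extend-reversed-prefixRotation 1 p p≗ pm _ = extend-as-ascending p≗ pm
extend-reversed-prefixRotation 2 p p≗ pm _ =
  rotated , inj₂ (grow (≗-trans p≗ (≗-by-evaluation 2 _ _)) (reversed-ascending-grows 2) pm)
extend-reversed-prefixRotation 3 p p≗ pm _ =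
  prefixRotated , inj₁ (grow (≗-trans p≗ (≗-by-evaluation 3 _ _)) (rotation-grows 3) pm)
extend-reversed-prefixRotation 4 p p≗ pm _ =
  valley , inj₁ (grow (≗-trans p≗ (≗-by-evaluation 4 _ _)) (valley-grows 2) pm)
extend-reversed-prefixRotation (suc (suc (suc (suc (suc k))))) p p≗ pm C = ⊥-elim (concave-at-end (3 + k) p C
  (trans (p≗ (3 + k) (m<n⇒m<1+n (n<1+n _)))
         (trans (cong (prefixRotation (5 + k)) (m+n∸n≡m 1 k)) (prefixRotation-init {4 + k} {1} λ ())))
  (trans (p≗ (4 + k) (n<1+n _))
         (trans (cong (prefixRotation (5 + k)) (n∸n≡0 k)) (prefixRotation-init {4 + k} {0} λ ())))
  pm (<-by-surplus k (surplus k)))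
  where
  surplus : ∀ k → (4 + k) + (4 + k) ≡ suc (k + (1 + (6 + k)))
  surplus = solve-∀

extend-valley : ∀ m p → p ≗[ m ] shape valley m → p m ≡ suc m → ConvexOn (suc m) p → ListedOn (suc m) p
extend-valley m p p≗ pm C with even-or-odd m
... | even k      = valley , inj₁ (grow p≗ (valley-grows k) pm)
... | odd zero    = extend-as-ascending p≗ pm
... | odd (suc j) = ⊥-elim (concave-at-end (j + suc j) p C
  (trans (p≗ _ (m<n⇒m<1+n (n<1+n _))) before-last) (trans (p≗ _ (n<1+n _)) last) pm (<-by-surplus 0 (surplus j)))
  where
  open ≡-Reasoning
  before-last : shape valley (suc (suc j + suc j)) (j + suc j) ≡ suc (j + j)
  before-last = begin
    shape valley (suc (suc j + suc j)) (j + suc j)  ≡⟨ valley-odd (suc j) (j + suc j) ⟩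
    zigzag (suc j) (j + suc j)                      ≡⟨ cong (zigzag (suc j)) (+-suc j j) ⟩
    zigzag (suc j) (suc (j + j))                    ≡⟨ zigzag-suc j (j + j) ⟩
    zigzag j (j + j)                                ≡⟨ zigzag-+ j j ⟩
    suc (j + j)                                     ∎
  last : shape valley (suc (suc j + suc j)) (suc (j + suc j)) ≡ suc (suc j + suc j)
  last = begin
    shape valley (suc (suc j + suc j)) (suc (j + suc j)) ≡⟨ valley-odd (suc j) (suc (j + suc j)) ⟩
    zigzag (suc j) (suc (j + suc j))                     ≡⟨ zigzag-suc j (j + suc j) ⟩
    zigzag j (j + suc j)                                 ≡⟨ zigzag-+ j (suc j) ⟩
    suc (suc j + suc j)                                  ∎
  surplus : ∀ j → suc (suc j + suc j) + suc (suc j + suc j) ≡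
                  suc (0 + (suc (j + j) + suc (suc (suc j + suc j))))
  surplus = solve-∀

extend-reversed-valley : ∀ m p → p ≗[ m ] reverseOn m (shape valley m) → p m ≡ suc m → ConvexOn (suc m) p →
                         ListedOn (suc m) p
extend-reversed-valley m p p≗ pm C with even-or-odd m
... | odd k  = valley , inj₂ (grow p≗ (reversed-valley-grows k) pm)
... | even 0 = extend-as-ascending p≗ pm
... | even 1 = extend-as-ascending p≗ pm
... | even (suc (suc j)) = ⊥-elim (concave-at-end (j + P) p C
  (trans (p≗ _ (m<n⇒m<1+n (n<1+n _))) before-last) (trans (p≗ _ (n<1+n _)) last) pm (<-by-surplus 0 (surplus j)))
  where
  open ≡-Reasoning
  P = suc (suc j)
  before-last : shape valley (P + P) (suc (j + P) ∸ (j + P)) ≡ suc j + suc j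
  before-last = begin
    shape valley (P + P) (suc (j + P) ∸ (j + P))  ≡⟨ cong (shape valley (P + P)) (m+n∸n≡m 1 (j + P)) ⟩
    shape valley (P + P) 1                        ≡⟨ valley-even P 1 ⟩
    zigzag P 1                                    ≡⟨ zigzag-< {P} {1} (s≤s (s≤s z≤n)) ⟩
    suc j + suc j                                 ∎
  last : shape valley (P + P) (j + P ∸ (j + P)) ≡ P + P
  last = begin
    shape valley (P + P) (j + P ∸ (j + P))  ≡⟨ cong (shape valley (P + P)) (n∸n≡0 (j + P)) ⟩
    shape valley (P + P) 0                  ≡⟨ valley-even P 0 ⟩
    zigzag P 0                              ≡⟨ zigzag-< {P} {0} (s≤s z≤n) ⟩
    P + P                                   ∎
  surplus : ∀ j → (suc (suc j) + suc (suc j)) + (suc (suc j) + suc (suc j)) ≡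
                  suc (0 + ((suc j + suc j) + suc (suc (suc j) + suc (suc j))))
  surplus = solve-∀

extend-listed : ∀ m p → ListedOn m p → p m ≡ suc m → ConvexOn (suc m) p → ListedOn (suc m) p
extend-listed m p (ascending     , inj₁ p≗) pm _ = ascending , inj₁ (grow p≗ (ascending-grows m) pm)
extend-listed m p (ascending     , inj₂ p≗) pm _ = rotated , inj₂ (grow p≗ (reversed-ascending-grows m) pm)
extend-listed m p (rotated       , inj₁ p≗) pm _ = prefixRotated , inj₁ (grow p≗ (rotation-grows m) pm)
extend-listed m p (rotated       , inj₂ p≗) pm C = extend-reversed-rotation m p p≗ pm C
extend-listed m p (prefixRotated , inj₁ p≗) pm C = extend-prefixRotation m p p≗ pm C
extend-listed m p (prefixRotated , inj₂ p≗) pm C = extend-reversed-prefixRotation m p p≗ pm C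
extend-listed m p (valley        , inj₁ p≗) pm C = extend-valley m p p≗ pm C
extend-listed m p (valley        , inj₂ p≗) pm C = extend-reversed-valley m p p≗ pm C

listed-with-maximum-last : ∀ m → (∀ q → PermutationOn (suc m) q → ConvexOn (suc m) q → ListedOn (suc m) q) →
                           ∀ p → PermutationOn (2 + m) p → ConvexOn (2 + m) p → p (1 + m) ≡ 2 + m →
                           ListedOn (2 + m) p
listed-with-maximum-last m listed p P C p[1+m]≡2+m =
  extend-listed (suc m) p (listed p (permutation-restrict P p[1+m]≡2+m) (convex-restrict {p = p} C)) p[1+m]≡2+m C

convex-permutation⇒listed : ∀ m p → PermutationOn (suc m) p → ConvexOn (suc m) p → ListedOn (suc m) p
convex-permutation⇒listed zero p (range , _) _ =
  extend-as-ascending {p = p} {f = suc} (λ _ ())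
                      (≤-antisym (proj₂ (range 0 (s≤s z≤n))) (proj₁ (range 0 (s≤s z≤n))))
convex-permutation⇒listed (suc m) p P C with maximum-attained P
... | i , i<2+m , pi≡2+m with maximum-at-end P C i<2+m pi≡2+m
...   | inj₂ refl = listed-with-maximum-last m (convex-permutation⇒listed m) p P C pi≡2+m
...   | inj₁ refl = listed-reverse (listed-with-maximum-last m (convex-permutation⇒listed m) (reverseOn (2 + m) p)
                      (reverseOn-permutation P) (reverseOn-convex {p = p} C) (trans (cong p (n∸n≡0 m)) pi≡2+m))

double≡*2 : ∀ h → h + h ≡ h * 2
double≡*2 = solve-∀

even-%2 : ∀ h → (h + h) % 2 ≡ 0
even-%2 h = trans (cong (_% 2) (double≡*2 h)) (m*n%n≡0 h 2)

even-/2 : ∀ h → (h + h) / 2 ≡ h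
even-/2 h = trans (/-congˡ (double≡*2 h)) (m*n/n≡m h 2)

odd-%2 : ∀ h → suc (h + h) % 2 ≡ 1
odd-%2 h = trans (cong (λ x → suc x % 2) (double≡*2 h)) ([m+kn]%n≡m%n 1 h 2)

odd-/2 : ∀ h → suc (h + h) / 2 ≡ h
odd-/2 h = begin
  suc (h + h) / 2       ≡⟨ /-congˡ {o = 2} (cong suc (double≡*2 h)) ⟩
  (1 + h * 2) / 2       ≡⟨ +-distrib-/ 1 (h * 2) (subst (λ x → 1 + x < 2) (sym (m*n%n≡0 h 2)) ≤-refl) ⟩
  0 + h * 2 / 2         ≡⟨ m*n/n≡m h 2 ⟩
  h                     ∎
  where open ≡-Reasoning

piEntry-even : ∀ r h q → r ≤ 1 → piEntry (r + (h + h)) (q + q) ≡ r + h ∸ q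
piEntry-even 0 h q z≤n rewrite even-%2 h | even-%2 q | even-/2 h | even-/2 q = refl
piEntry-even 1 h q (s≤s z≤n) rewrite odd-%2 h | even-%2 q | odd-/2 h | even-/2 q = refl

piEntry-odd : ∀ r h q → r ≤ 1 → piEntry (r + (h + h)) (suc (q + q)) ≡ suc (r + h + q)
piEntry-odd 0 h q z≤n rewrite even-%2 h | odd-%2 q | even-/2 h | odd-/2 q = refl
piEntry-odd 1 h q (s≤s z≤n) rewrite odd-%2 h | odd-%2 q | odd-/2 h | odd-/2 q = refl

halve : ∀ n → ∃₂ λ r h → r ≤ 1 × r + (h + h) ≡ n
halve n with even-or-odd n
... | even h = 0 , h , z≤n , refl
... | odd h  = 1 , h , s≤s z≤n , refl

valley-halved : ∀ {r} h i → r ≤ 1 → shape valley (r + (h + h)) i ≡ zigzag h i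
valley-halved h i z≤n       = valley-even h i
valley-halved h i (s≤s z≤n) = valley-odd h i

valley-piEntry-left : ∀ {r h} a t → r ≤ 1 → suc (a + t) ≡ h →
                      shape valley (r + (h + h)) a ≡ suc (suc (t + t)) ×
                      piEntry (r + (h + h)) (suc (t + t)) ≡ r + (h + h) ∸ a
valley-piEntry-left {r} {h} a t r≤1 refl = value , entry
  where
  open ≡-Reasoning
  shifted : ∀ r a t → r + (suc (a + t) + suc (a + t)) ≡ a + suc (r + suc (a + t) + t)
  shifted = solve-∀
  value = begin
    shape valley (r + (h + h)) a  ≡⟨ valley-halved h a r≤1 ⟩
    zigzag h a                    ≡⟨ zigzag-< (s≤s (m≤m+n a t)) ⟩
    (h ∸ a) + (h ∸ a)             ≡⟨ cong (λ x → x + x) (+-∸-assoc 1 (m≤m+n a t)) ⟩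
    suc (a + t ∸ a) + suc (a + t ∸ a) ≡⟨ cong (λ x → suc x + suc x) (m+n∸m≡n a t) ⟩
    suc t + suc t                 ≡⟨ cong suc (+-suc t t) ⟩
    suc (suc (t + t))             ∎
  entry = begin
    piEntry (r + (h + h)) (suc (t + t))  ≡⟨ piEntry-odd r h t r≤1 ⟩
    suc (r + h + t)                      ≡⟨ m+n∸m≡n a _ ⟨
    a + suc (r + h + t) ∸ a              ≡⟨ cong (_∸ a) (shifted r a t) ⟨
    r + (h + h) ∸ a                      ∎

valley-piEntry-right : ∀ {r h a} t → r ≤ 1 → h + t ≡ a →
                       shape valley (r + (h + h)) a ≡ suc (t + t) ×
                       piEntry (r + (h + h)) (t + t) ≡ r + (h + h) ∸ a
valley-piEntry-right {r} {h} t r≤1 refl = trans (valley-halved h (h + t) r≤1) (zigzag-+ h t) , entry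
  where
  open ≡-Reasoning
  rearranged : ∀ r h → r + (h + h) ≡ h + (r + h)
  rearranged = solve-∀
  entry = begin
    piEntry (r + (h + h)) (t + t)  ≡⟨ piEntry-even r h t r≤1 ⟩
    r + h ∸ t                      ≡⟨ [m+n]∸[m+o]≡n∸o h (r + h) t ⟨
    h + (r + h) ∸ (h + t)          ≡⟨ cong (_∸ (h + t)) (rearranged r h) ⟨
    r + (h + h) ∸ (h + t)          ∎

valley-piEntry-at-position : ∀ {n a} → a < n →
                             ∃[ b ] (b < n × shape valley n a ≡ suc b × piEntry n b ≡ n ∸ a)
valley-piEntry-at-position {n} {a} a<n with halve n
... | r , h , r≤1 , refl with a <? h
...   | yes a<h = suc (t + t) , 1+2t<n , valley-piEntry-left a t r≤1 (m+[n∸m]≡n a<h)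
  where
  t = h ∸ suc a
  1+2t<n : suc (t + t) < r + (h + h)
  1+2t<n = ≤-trans (≤-reflexive (cong suc (sym (+-suc t t))))
                   (≤-trans (+-mono-≤ t<h t<h) (m≤n+m (h + h) r))
    where
    t<h : t < h
    t<h = subst (t <_) (m+[n∸m]≡n a<h) (s≤s (m≤n+m t a))
...   | no a≮h = t + t , 2t<n , valley-piEntry-right t r≤1 (m+[n∸m]≡n (≮⇒≥ a≮h))
  where
  t = a ∸ h
  t<r+h : t < r + h
  t<r+h = +-cancelˡ-< h t (r + h)
            (subst₂ _<_ (sym (m+[n∸m]≡n (≮⇒≥ a≮h))) (trans (sym (+-assoc r h h)) (+-comm (r + h) h)) a<n)
  2t<n : t + t < r + (h + h)
  2t<n = subst (t + t <_) (+-assoc r h h)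
               (+-mono-<-≤ t<r+h (s≤s⁻¹ (≤-trans t<r+h (+-monoˡ-≤ h r≤1))))

valley-piEntry-at-value : ∀ {n b} → b < n → ∃[ a ] (shape valley n a ≡ suc b × piEntry n b ≡ n ∸ a)
valley-piEntry-at-value {n} {b} b<n with halve n
... | r , h , r≤1 , refl with even-or-odd b
...   | even q = h + q , valley-piEntry-right q r≤1 refl
...   | odd q  = h ∸ suc q , valley-piEntry-left (h ∸ suc q) q r≤1
                               (trans (cong suc (+-comm (h ∸ suc q) q)) (m+[n∸m]≡n q<h))
  where
  q<h : q < h
  q<h = ≰⇒> λ h≤q → 1+n≰n (≤-trans b<n (≤-trans (+-monoʳ-≤ r (+-mono-≤ h≤q h≤q))
                                                 (+-monoˡ-≤ (q + q) r≤1)))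

-- After the rotation, Π*_n has its 1 at (a, b) exactly when piEntry n b = n − a.
valley≡suc⇔piEntry≡ : ∀ {n a b} → a < n → b < n → (shape valley n a ≡ suc b ⇔ piEntry n b ≡ n ∸ a)
valley≡suc⇔piEntry≡ {n} {a} {b} a<n b<n = mk⇔ to from
  where
  to : shape valley n a ≡ suc b → piEntry n b ≡ n ∸ a
  to valley≡1+b with valley-piEntry-at-position a<n
  ... | b′ , _ , valley≡1+b′ , entry =
    subst (λ x → piEntry n x ≡ n ∸ a) (suc-injective (trans (sym valley≡1+b′) valley≡1+b)) entry
  from : piEntry n b ≡ n ∸ a → shape valley n a ≡ suc b
  from entry≡ with valley-piEntry-at-value b<n
  ... | a′ , valley≡1+b , entry′ = subst (λ x → shape valley n x ≡ suc b) (sym a≡a′) valley≡1+b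
    where
    n∸a≡n∸a′ : n ∸ a ≡ n ∸ a′
    n∸a≡n∸a′ = trans (sym entry≡) entry′
    a′<n : a′ < n
    a′<n = m∸n≢0⇒n<m λ n∸a′≡0 → m>n⇒m∸n≢0 a<n (trans n∸a≡n∸a′ n∸a′≡0)
    a≡a′ : a ≡ a′
    a≡a′ = ∸-cancelˡ-≡ (<⇒≤ a<n) (<⇒≤ a′<n) n∸a≡n∸a′

entry : ∀ {n} → Vec ℕ n → ℕ → ℕ
entry []       _       = 0
entry (x ∷ xs) zero    = x
entry (x ∷ xs) (suc i) = entry xs i

entry-fromℕ< : ∀ {n} (π : Vec ℕ n) {i} (i<n : i < n) → entry π i ≡ lookup π (fromℕ< i<n)
entry-fromℕ< (x ∷ xs) {zero}  _         = refl
entry-fromℕ< (x ∷ xs) {suc i} (s≤s i<n) = entry-fromℕ< xs i<n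

entry-toℕ : ∀ {n} (π : Vec ℕ n) j → entry π (toℕ j) ≡ lookup π j
entry-toℕ (x ∷ xs) Fin.zero    = refl
entry-toℕ (x ∷ xs) (Fin.suc j) = entry-toℕ xs j

entry-injective : ∀ {n} (σ τ : Vec ℕ n) → entry σ ≗[ n ] entry τ → σ ≡ τ
entry-injective []       []       _   = refl
entry-injective (x ∷ xs) (y ∷ ys) σ≗τ =
  cong₂ _∷_ (σ≗τ 0 (s≤s z≤n)) (entry-injective xs ys λ i i<n → σ≗τ (suc i) (s≤s i<n))

entry-tabulate : ∀ {n} (σ : Vec ℕ n) f → (∀ j → lookup σ j ≡ f (toℕ j)) → entry σ ≗[ n ] f
entry-tabulate σ f lookup≡ i i<n =
  trans (entry-fromℕ< σ i<n) (trans (lookup≡ _) (cong f (Finₚ.toℕ-fromℕ< i<n)))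

entry-∷ʳ-< : ∀ {n} (xs : Vec ℕ n) x {i} → i < n → entry (xs ∷ʳ x) i ≡ entry xs i
entry-∷ʳ-< (y ∷ ys) x {zero}  _         = refl
entry-∷ʳ-< (y ∷ ys) x {suc i} (s≤s i<n) = entry-∷ʳ-< ys x i<n

entry-∷ʳ-last : ∀ {n} (xs : Vec ℕ n) x → entry (xs ∷ʳ x) n ≡ x
entry-∷ʳ-last []       x = refl
entry-∷ʳ-last (y ∷ ys) x = entry-∷ʳ-last ys x

entry-reverse : ∀ {n} (σ : Vec ℕ n) → entry (reverse σ) ≗[ n ] reverseOn n (entry σ)
entry-reverse {suc n} (x ∷ xs) i i<1+n rewrite reverse-∷ x xs with m<1+n⇒m<n∨m≡n i<1+n
... | inj₁ i<n  = trans (entry-∷ʳ-< (reverse xs) x i<n)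
                        (trans (entry-reverse xs i i<n) (cong (entry (x ∷ xs)) (sym (+-∸-assoc 1 i<n))))
... | inj₂ refl = trans (entry-∷ʳ-last (reverse xs) x) (cong (entry (x ∷ xs)) (sym (n∸n≡0 n)))

convex-step⇔ : ∀ a b c → ((ℤ.+ b) ℤ.- (ℤ.+ a) ℤ.≤ (ℤ.+ c) ℤ.- (ℤ.+ b)) ⇔ (b + b ≤ a + c)
convex-step⇔ a b c = mk⇔
  (λ step → ℤₚ.drop‿+≤+ (subst₂ ℤ._≤_ left right (ℤₚ.+-monoˡ-≤ shift step)))
  (λ step → subst₂ ℤ._≤_ (unshift _ shift) (unshift _ shift)
              (ℤₚ.+-monoˡ-≤ (ℤ.- shift) (subst₂ ℤ._≤_ (sym left) (sym right) (ℤ.+≤+ step))))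
  where
  shift = ℤ.+ a ℤ.+ ℤ.+ b
  shifted-left : ∀ a b → (b ℤ.- a) ℤ.+ (a ℤ.+ b) ≡ b ℤ.+ b
  shifted-left = ℤ-Solver.solve-∀
  shifted-right : ∀ a b c → (c ℤ.- b) ℤ.+ (a ℤ.+ b) ≡ a ℤ.+ c
  shifted-right = ℤ-Solver.solve-∀
  unshift : ∀ x k → (x ℤ.+ k) ℤ.- k ≡ x
  unshift = ℤ-Solver.solve-∀
  left : ((ℤ.+ b) ℤ.- (ℤ.+ a)) ℤ.+ shift ≡ ℤ.+ (b + b)
  left = trans (shifted-left (ℤ.+ a) (ℤ.+ b)) (sym (ℤₚ.pos-+ b b))
  right : ((ℤ.+ c) ℤ.- (ℤ.+ b)) ℤ.+ shift ≡ ℤ.+ (a + c)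
  right = trans (shifted-right (ℤ.+ a) (ℤ.+ b) (ℤ.+ c)) (sym (ℤₚ.pos-+ a c))

Convex⇔ConvexOn : ∀ {n} (π : Vec ℕ n) → Convex (toList π) ⇔ ConvexOn n (entry π)
Convex⇔ConvexOn π = mk⇔ (to π) (from π)
  where
  to : ∀ {n} (π : Vec ℕ n) → Convex (toList π) → ConvexOn n (entry π)
  to (a ∷ b ∷ c ∷ ρ) (step , _)    zero    _         = Equivalence.to (convex-step⇔ a b c) step
  to (a ∷ b ∷ c ∷ ρ) (_ , convex) (suc i) 3+i<n     = to (b ∷ c ∷ ρ) convex i (s≤s⁻¹ 3+i<n)
  to (a ∷ b ∷ [])   _ i (s≤s (s≤s ()))
  to (a ∷ [])       _ i (s≤s ())
  to []             _ i ()
  from : ∀ {n} (π : Vec ℕ n) → ConvexOn n (entry π) → Convex (toList π)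
  from []              _ = tt
  from (a ∷ [])        _ = tt
  from (a ∷ b ∷ [])    _ = tt
  from (a ∷ b ∷ c ∷ ρ) C = Equivalence.from (convex-step⇔ a b c) (C 0 (s≤s (s≤s (s≤s z≤n)))) ,
                           from (b ∷ c ∷ ρ) λ i 3+i<n → C (suc i) (s≤s 3+i<n)

IsPerm⇒PermutationOn : ∀ {n} (π : Vec ℕ n) → IsPerm π → PermutationOn n (entry π)
IsPerm⇒PermutationOn {n} π (range , injective) =
  (λ i i<n → subst (λ x → 1 ≤ x × x ≤ n) (sym (entry-fromℕ< π i<n)) (range (fromℕ< i<n))) ,
  (λ i j i<n j<n πi≡πj → begin
     i                    ≡⟨ Finₚ.toℕ-fromℕ< i<n ⟨
     toℕ (fromℕ< i<n)     ≡⟨ cong toℕ (injective _ _ (trans (sym (entry-fromℕ< π i<n))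
                                                            (trans πi≡πj (entry-fromℕ< π j<n)))) ⟩
     toℕ (fromℕ< j<n)     ≡⟨ Finₚ.toℕ-fromℕ< j<n ⟩
     j                    ∎)
  where open ≡-Reasoning

lookup-permII : ∀ n j → lookup (permII n) j ≡ rotation n (toℕ j)
lookup-permII n j rewrite (lookup (permII n) j ≡ _) ∋ lookup∘tabulate _ j with toℕ j
... | zero  = refl
... | suc _ = refl

lookup-permIII : ∀ n j → lookup (permIII n) j ≡ prefixRotation n (toℕ j)
lookup-permIII n j rewrite (lookup (permIII n) j ≡ _) ∋ lookup∘tabulate _ j with toℕ j ≟ n ∸ 1
lookup-permIII n       j           | yes _ = refl
lookup-permIII (suc n) Fin.zero    | no _  = refl
lookup-permIII (suc n) (Fin.suc j) | no _  = refl

permMatrix≡1⇔ : ∀ {n} (π : Vec ℕ n) i j → permMatrix π i j ≡ 1 ⇔ lookup π i ≡ suc (toℕ j)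
permMatrix≡1⇔ π i j with lookup π i ≟ suc (toℕ j)
... | yes πi≡1+j = mk⇔ (λ _ → πi≡1+j) (λ _ → refl)
... | no πi≢1+j  = mk⇔ (λ ()) (λ πi≡1+j → ⊥-elim (πi≢1+j πi≡1+j))

permMatrix-cong : ∀ {m n} (π : Vec ℕ m) (τ : Vec ℕ n) i j k l →
                  (lookup π i ≡ suc (toℕ j) ⇔ lookup τ k ≡ suc (toℕ l)) →
                  permMatrix π i j ≡ permMatrix τ k l
permMatrix-cong π τ i j k l hit⇔hit with lookup π i ≟ suc (toℕ j) | lookup τ k ≟ suc (toℕ l)
... | yes _    | yes _     = refl
... | no _     | no _      = refl
... | yes hit  | no ¬hit′  = ⊥-elim (¬hit′ (Equivalence.to hit⇔hit hit))
... | no ¬hit  | yes hit′  = ⊥-elim (¬hit (Equivalence.from hit⇔hit hit′))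

suc-opposite : ∀ {n} (a : Fin n) → suc (toℕ (opposite a)) ≡ n ∸ toℕ a
suc-opposite {suc n} a = trans (cong suc (Finₚ.opposite-prop a)) (sym (+-∸-assoc 1 (s≤s⁻¹ (Finₚ.toℕ<n a))))

piStar-hit⇔valley : ∀ {n} (a b : Fin n) →
                    lookup (piPerm n) b ≡ suc (toℕ (opposite a)) ⇔ shape valley n (toℕ a) ≡ suc (toℕ b)
piStar-hit⇔valley {n} a b = mk⇔
  (λ hit → Equivalence.from valley⇔entry (trans (sym lookup-piPerm) (trans hit (suc-opposite a))))
  (λ v → trans lookup-piPerm (trans (Equivalence.to valley⇔entry v) (sym (suc-opposite a))))
  where
  valley⇔entry = valley≡suc⇔piEntry≡ (Finₚ.toℕ<n a) (Finₚ.toℕ<n b)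
  lookup-piPerm : lookup (piPerm n) b ≡ piEntry n (toℕ b)
  lookup-piPerm = lookup∘tabulate _ b

PiStar⇔valley : ∀ {n} (σ : Vec ℕ n) →
                (∀ a b → permMatrix σ a b ≡ PiStar n a b) ⇔ entry σ ≗[ n ] shape valley n
PiStar⇔valley {n} σ = mk⇔ to from
  where
  to : (∀ a b → permMatrix σ a b ≡ PiStar n a b) → entry σ ≗[ n ] shape valley n
  to M i i<n with valley-piEntry-at-position i<n
  ... | b , b<n , valley≡1+b , _ = begin
    entry σ i                   ≡⟨ entry-fromℕ< σ i<n ⟩
    lookup σ a                  ≡⟨ Equivalence.to (permMatrix≡1⇔ σ a b′) (trans (M a b′) piStar-hit) ⟩
    suc (toℕ b′)                ≡⟨ cong suc (Finₚ.toℕ-fromℕ< b<n) ⟩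
    suc b                       ≡⟨ valley≡1+b ⟨
    shape valley n i            ∎
    where
    open ≡-Reasoning
    a = fromℕ< i<n
    b′ = fromℕ< b<n
    piStar-hit : PiStar n a b′ ≡ 1
    piStar-hit = Equivalence.from (permMatrix≡1⇔ (piPerm n) b′ (opposite a))
                   (Equivalence.from (piStar-hit⇔valley a b′)
                     (trans (cong (shape valley n) (Finₚ.toℕ-fromℕ< i<n))
                            (trans valley≡1+b (cong suc (sym (Finₚ.toℕ-fromℕ< b<n))))))
  from : entry σ ≗[ n ] shape valley n → ∀ a b → permMatrix σ a b ≡ PiStar n a b
  from σ≗valley a b = permMatrix-cong σ (piPerm n) a b b (opposite a) (mk⇔
    (λ hit → Equivalence.from (piStar-hit⇔valley a b) (trans (sym σa≡valley) hit))
    (λ hit → trans σa≡valley (Equivalence.to (piStar-hit⇔valley a b) hit)))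
    where
    σa≡valley : lookup σ a ≡ shape valley n (toℕ a)
    σa≡valley = trans (sym (entry-toℕ σ a)) (σ≗valley (toℕ a) (Finₚ.toℕ<n a))

Base⇔shape : ∀ {n} (σ : Vec ℕ n) → Base σ ⇔ (∃[ s ] entry σ ≗[ n ] shape s n)
Base⇔shape {n} σ = mk⇔ to from
  where
  entry-permI : entry (permI n) ≗[ n ] shape ascending n
  entry-permI = entry-tabulate (permI n) suc (lookup∘tabulate _)
  entry-permII : entry (permII n) ≗[ n ] shape rotated n
  entry-permII = entry-tabulate (permII n) (rotation n) (lookup-permII n)
  entry-permIII : entry (permIII n) ≗[ n ] shape prefixRotated n
  entry-permIII = entry-tabulate (permIII n) (prefixRotation n) (lookup-permIII n)
  to : Base σ → ∃[ s ] entry σ ≗[ n ] shape s n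
  to (inj₁ refl)                = ascending , entry-permI
  to (inj₂ (inj₁ refl))         = rotated , entry-permII
  to (inj₂ (inj₂ (inj₁ refl)))  = prefixRotated , entry-permIII
  to (inj₂ (inj₂ (inj₂ M)))     = valley , Equivalence.to (PiStar⇔valley σ) M
  from : ∃[ s ] entry σ ≗[ n ] shape s n → Base σ
  from (ascending , σ≗)     = inj₁ (entry-injective σ (permI n) (≗-trans σ≗ (≗-sym entry-permI)))
  from (rotated , σ≗)       = inj₂ (inj₁ (entry-injective σ (permII n) (≗-trans σ≗ (≗-sym entry-permII))))
  from (prefixRotated , σ≗) =
    inj₂ (inj₂ (inj₁ (entry-injective σ (permIII n) (≗-trans σ≗ (≗-sym entry-permIII)))))
  from (valley , σ≗)        = inj₂ (inj₂ (inj₂ (Equivalence.from (PiStar⇔valley σ) σ≗)))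

Listed⇔ListedOn : ∀ {n} (π : Vec ℕ n) → Listed π ⇔ ListedOn n (entry π)
Listed⇔ListedOn {n} π = mk⇔ to from
  where
  to : Listed π → ListedOn n (entry π)
  to (inj₁ base) with Equivalence.to (Base⇔shape π) base
  ... | s , π≗s = s , inj₁ π≗s
  to (inj₂ (σ , base , refl)) with Equivalence.to (Base⇔shape σ) base
  ... | s , σ≗s = s , inj₂ (≗-trans (entry-reverse σ) (reverseOn-cong σ≗s))
  from : ListedOn n (entry π) → Listed π
  from (s , inj₁ π≗s)  = inj₁ (Equivalence.from (Base⇔shape π) (s , π≗s))
  from (s , inj₂ π≗rs) = inj₂ (reverse π , Equivalence.from (Base⇔shape (reverse π)) (s , reversed) ,
                               sym (reverse-involutive π))
    where
    reversed : entry (reverse π) ≗[ n ] shape s n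
    reversed = ≗-trans (entry-reverse π) (≗-trans (reverseOn-cong π≗rs) (reverseOn-involutive n (shape s n)))

theorem4p4 : (n : ℕ) → 1 ≤ n → (π : Vec ℕ n) → IsPerm π →
    (Convex (toList π) ⇔ Listed π)
theorem4p4 (suc m) _ π isPerm = mk⇔
  (λ convex → Equivalence.from (Listed⇔ListedOn π)
                (convex-permutation⇒listed m (entry π) (IsPerm⇒PermutationOn π isPerm)
                  (Equivalence.to (Convex⇔ConvexOn π) convex)))
  (λ listed → Equivalence.from (Convex⇔ConvexOn π) (listed⇒convex (Equivalence.to (Listed⇔ListedOn π) listed)))
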